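{- Let $A_1,A_2,A_3,A_4$ be a $4$-set ridge cover of the $4$-cube $C^4$ such that no $A_i$ contains a pair of antipodal edges. Then each $A_i$ consists of exactly six ridges, and each $A_i$ either consists of all six ridges of a single facet of $C^4$ or is an asterisk set $Ast(v)$ for some vertex $v$ of $C^4$.
   Context: $C^4=[0,1]^4$. A $k$-face of $C^4$ is given by a word in $\{0,1,X\}^4$ with exactly $k$ letters $X$ (the set of points agreeing with the word in the non-$X$, "fixed", positions). Two $k$-faces are antipodal iff they have exactly the same fixed positions and differ in every fixed position. Ridges of $C^4$ are its $2$-faces (there are $24$), facets its $3$-faces, edges its $1$-faces. A $4$-set ridge cover is a collection of four sets, each a set (union) of ridges, such that every ridge lies in at least one set. A set contains a pair of antipodal edges if two antipodal edges are both contained in it. For a vertex $v$, the asterisk set $Ast(v)$ is the set of all ridges containing $v$ (the $\binom{4}{2}=6$ ridges obtained by replacing two coordinates of $v$ by $X$). -}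

module Defs where

open import Data.Nat using (ℕ)
open import Data.Fin using (Fin)
open import Data.Vec using (Vec; count)
open import Data.Bool using (Bool; true; false; T)
open import Data.List using (List; length; filter)
open import Data.Product using (Σ; ∃; _×_)
open import Relation.Binary.PropositionalEquality using (_≡_; _≢_)
open import Relation.Unary using (Pred)

-- Letters of a face word: 0, 1, or X (free coordinate).
data Letter : Set where
  O I X : Letter

-- A word in {0,1,X}^4 describing a face of C^4.
Word : Set
Word = Vec Letter 4

isX : Letter → Bool
isX X = true
isX _ = false

dim : Word → ℕ
dim w = count (λ l → Data.Bool._≟_ (isX l) true) w
  where import Data.Bool

IsFace : ℕ → Word → Set
IsFace k w = dim w ≡ k

IsRidge IsEdge IsFacet IsVertex : Word → Set
IsRidge = IsFace 2
IsEdge = IsFace 1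
IsFacet = IsFace 3
IsVertex = IsFace 0

data _⊑ˡ_ : Letter → Letter → Set where
  refl⊑ : ∀ {a} → a ⊑ˡ a
  toX : ∀ {a} → a ⊑ˡ X

-- Face inclusion (as point sets of C^4): agree in every fixed position of the larger face
_⊑_ : Word → Word → Set
u ⊑ w = ∀ (i : Fin 4) → Data.Vec.lookup u i ⊑ˡ Data.Vec.lookup w i

data Antiˡ : Letter → Letter → Set where
  XX : Antiˡ X X
  OI : Antiˡ O I
  IO : Antiˡ I O

Antipodal : Word → Word → Set
Antipodal u w = ∀ (i : Fin 4) → Antiˡ (Data.Vec.lookup u i) (Data.Vec.lookup w i)

-- A set of ridges: a subset of words all of whose members are ridges
-- (given as a Boolean characteristic function on words; sets of ridges are finite, hence decidable)
RidgeSet : Set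
RidgeSet = Σ (Word → Bool) (λ A → ∀ w → T (A w) → IsRidge w)

_∈R_ : Word → RidgeSet → Set
w ∈R A = T (Data.Product.proj₁ A w)

-- a face is contained in (the union of) A: it lies in some ridge of A
FaceIn : Word → RidgeSet → Set
FaceIn e A = ∃ λ r → r ∈R A × e ⊑ r

ContainsAntipodalEdges : RidgeSet → Set
ContainsAntipodalEdges A =
  ∃ λ e → ∃ λ e' → IsEdge e × IsEdge e' × Antipodal e e' × FaceIn e A × FaceIn e' A

IsRidgeCover : (Fin 4 → RidgeSet) → Set
IsRidgeCover As = ∀ r → IsRidge r → ∃ λ i → r ∈R As i

open import Data.List.Relation.Unary.Unique.Propositional using (Unique)
open import Data.List.Membership.Propositional using (_∈_)
open import Function.Bundles using (_⇔_)

HasCard : RidgeSet → ℕ → Set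
HasCard A n = Σ (List Word) λ ws → Unique ws × length ws ≡ n × (∀ w → (w ∈ ws) ⇔ (w ∈R A))

IsFacetSet : RidgeSet → Word → Set
IsFacetSet A F = ∀ r → (r ∈R A) ⇔ (IsRidge r × r ⊑ F)

IsAst : RidgeSet → Word → Set
IsAst A v = ∀ r → (r ∈R A) ⇔ (IsRidge r × v ⊑ r)

module Submission where

-- Call two ridges clashing if an edge of one is opposite to an edge of the other; a set
-- without antipodal edges consists of pairwise non-clashing ridges.  The clash graph on the
-- 24 ridges is small enough to enumerate all of its independent sets: each has at most six
-- ridges, and those with six are exactly the facet ridge sets and the asterisks.  Four sets
-- of at most six ridges covering 24 ridges must then each have exactly six.

open import Defs
open import Data.Fin using (Fin; zero; suc; punchIn)
open import Data.Product using (∃; _×_)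
open import Data.Sum using (_⊎_)
open import Relation.Nullary using (¬_)

open import Data.Bool using (Bool; true; T; _∧_; _∨_)
open import Data.Bool.Properties using (T-∧; T-∨)
open import Data.Empty using (⊥-elim)
open import Data.Fin.Properties using (all?)
open import Data.List
  using (List; []; _∷_; _++_; [_]; length; filter; map; cartesianProductWith)
open import Data.List.Membership.Propositional using (_∈_; find)
open import Data.List.Membership.Propositional.Properties
  using (∈-cartesianProductWith⁺; ∈-filter⁺; ∈-filter⁻)
open import Data.List.Properties using (++-assoc; ++-identityʳ; length-++; filter-++; filter-accept)
open import Data.List.Relation.Unary.All as All using (All; []; _∷_)
open import Data.List.Relation.Unary.All.Properties using (++⁺)
open import Data.List.Relation.Unary.AllPairs using ([]; _∷_)
open import Data.List.Relation.Unary.Any using (Any; here; there; any?)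
open import Data.List.Relation.Unary.Unique.Propositional using (Unique)
import Data.List.Relation.Unary.Unique.Propositional.Properties as Unique
open import Data.Nat using (ℕ; zero; suc; _+_; _*_; _≤_; z≤n)
import Data.Nat as ℕ
open import Data.Nat.Properties using (+-0-commutativeMonoid; m≤m+n; module ≤-Reasoning; +-mono-≤; +-monoʳ-≤; +-cancelʳ-≤; ≤-antisym; ≤-trans; ≤-reflexive)
open import Data.Product using (_,_; proj₁; proj₂)
open import Algebra.Properties.CommutativeMonoid.Sum +-0-commutativeMonoid
  using (sum; sum-syntax; ∑-distrib-+; sum-remove; sum-cong-≗)
open import Data.Sum using (inj₁; inj₂)
open import Data.Unit using (tt)
open import Data.Vec using (Vec; []; _∷_; lookup; count)
import Data.Vec as Vec
open import Data.Vec.Properties using (∷-injective; lookup-map; ≡-dec)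
open import Data.Vec.Functional using (Vector; removeAt)
open import Function using (_∘_)
open import Function.Bundles using (_⇔_; mk⇔; Equivalence)
open import Relation.Binary.Definitions using (Decidable; DecidableEquality)
open import Relation.Binary.PropositionalEquality using (_≡_; refl; sym; trans; cong; subst)
open import Relation.Nullary.Decidable using (Dec; yes; no; isYes; toWitness; T?; _×-dec_; _⊎-dec_; _→-dec_)
import Relation.Unary as U
open import Level using (0ℓ)

open Equivalence using (to; from)

term≤sum : ∀ {n} (t : Vector ℕ n) i → t i ≤ sum t
term≤sum {suc n} t i = ≤-trans (m≤m+n (t i) _) (≤-reflexive (sym (sum-remove t)))

sum-bounded : ∀ {n m} (t : Vector ℕ n) → (∀ i → t i ≤ m) → sum t ≤ n * m
sum-bounded {zero} t _ = z≤n
sum-bounded {suc n} t t≤m = +-mono-≤ (t≤m zero) (sum-bounded (t ∘ suc) (t≤m ∘ suc))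

sum-maximal⇒terms-maximal : ∀ {n m} (t : Vector ℕ n) → (∀ i → t i ≤ m) → n * m ≤ sum t → ∀ i → t i ≡ m
sum-maximal⇒terms-maximal {suc n} {m} t t≤m n*m≤∑t i =
  ≤-antisym (t≤m i) (+-cancelʳ-≤ (n * m) m (t i) m+n*m≤tᵢ+n*m)
  where
  open ≤-Reasoning
  m+n*m≤tᵢ+n*m : m + n * m ≤ t i + n * m
  m+n*m≤tᵢ+n*m = begin
    m + n * m                ≤⟨ n*m≤∑t ⟩
    sum t                    ≡⟨ sum-remove t ⟩
    t i + sum (removeAt t i) ≤⟨ +-monoʳ-≤ (t i) (sum-bounded (removeAt t i) (t≤m ∘ punchIn i)) ⟩
    t i + n * m              ∎

length≤∑-length-filter : {A : Set} {n : ℕ} {P : Fin n → U.Pred A 0ℓ} (P? : ∀ i → U.Decidable (P i)) →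
  ∀ xs → (∀ {x} → x ∈ xs → ∃ λ i → P i x) → length xs ≤ ∑[ i < n ] length (filter (P? i) xs)
length≤∑-length-filter P? [] _ = z≤n
length≤∑-length-filter {n = n} P? (x ∷ xs) covered = begin
  1 + length xs                                   ≤⟨ +-mono-≤ x-counted counted ⟩
  ∑[ i < n ] ∣ i ∣ [ x ] + ∑[ i < n ] ∣ i ∣ xs     ≡⟨ ∑-distrib-+ (λ i → ∣ i ∣ [ x ]) (λ i → ∣ i ∣ xs) ⟨
  ∑[ i < n ] (∣ i ∣ [ x ] + ∣ i ∣ xs)              ≡⟨ sum-cong-≗ (λ i → ∣∣-++ i [ x ] xs) ⟨
  ∑[ i < n ] ∣ i ∣ (x ∷ xs)                        ∎
  where
  open ≤-Reasoning
  ∣_∣ : Fin n → List _ → ℕ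
  ∣ i ∣ ys = length (filter (P? i) ys)
  ∣∣-++ : ∀ i ys zs → ∣ i ∣ (ys ++ zs) ≡ ∣ i ∣ ys + ∣ i ∣ zs
  ∣∣-++ i ys zs = trans (cong length (filter-++ (P? i) ys zs)) (length-++ (filter (P? i) ys))
  counted : length xs ≤ ∑[ i < n ] ∣ i ∣ xs
  counted = length≤∑-length-filter P? xs (covered ∘ there)
  x-counted : 1 ≤ ∑[ i < n ] ∣ i ∣ [ x ]
  x-counted = let i , Pix = covered (here refl)
              in ≤-trans (≤-reflexive (cong length (sym (filter-accept (P? i) Pix)))) (term≤sum (λ i → ∣ i ∣ [ x ]) i)

vectors : {A : Set} → List A → ∀ n → List (Vec A n)
vectors xs zero = [ [] ]
vectors xs (suc n) = cartesianProductWith _∷_ xs (vectors xs n)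

∈-vectors : {A : Set} {xs : List A} → (∀ x → x ∈ xs) → ∀ {n} (v : Vec A n) → v ∈ vectors xs n
∈-vectors ∈xs [] = here refl
∈-vectors ∈xs (x ∷ v) = ∈-cartesianProductWith⁺ _∷_ (∈xs x) (∈-vectors ∈xs v)

vectors-unique : {A : Set} {xs : List A} → Unique xs → ∀ n → Unique (vectors xs n)
vectors-unique u zero = [] ∷ []
vectors-unique u (suc n) = Unique.cartesianProductWith⁺ _∷_ ∷-injective u (vectors-unique u n)

module IndependentSets {A : Set} (_≟_ : DecidableEquality A)
                       {Clash : A → A → Set} (clash? : Decidable Clash)
                       (universe : List A) where

  open import Data.List.Membership.DecPropositional _≟_ using (_∈?_)

  neighbours : A → List A
  neighbours x = filter (clash? x) universe

  withNeighbours : List A → List (A × List A)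
  withNeighbours = map (λ x → x , neighbours x)

  Independent : U.Pred A 0ℓ → Set
  Independent P = ∀ {x y} → P x → P y → ¬ Clash x y

  module _ {Good : U.Pred (List A) 0ℓ} (good? : U.Decidable Good) where

    -- The neighbour lists are kept in a table rather than recomputed, so that normalisation
    -- shares them between the branches of the search.
    allGood : List A → List (A × List A) → Bool
    allGood chosen [] = isYes (good? chosen)
    allGood chosen ((x , nx) ∷ rest) =
      allGood chosen rest ∧ (isYes (any? (_∈? nx) chosen) ∨ allGood (chosen ++ [ x ]) rest)

    allGood-sound : ∀ {P} (P? : U.Decidable P) → Independent P → ∀ {chosen} xs → All P chosen →
                    T (allGood chosen (withNeighbours xs)) → Good (chosen ++ filter P? xs)
    allGood-sound P? indep [] _ ok = subst Good (sym (++-identityʳ _)) (toWitness ok)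
    allGood-sound P? indep {chosen} (x ∷ xs) chosen⊆P ok
      with skip , add ← to T-∧ ok | P? x
    ... | no _ = allGood-sound P? indep xs chosen⊆P skip
    ... | yes Px with to T-∨ add
    ...   | inj₁ clashes = let y , y∈chosen , y∈nx = find (toWitness clashes)
                           in ⊥-elim (indep Px (All.lookup chosen⊆P y∈chosen)
                                                (proj₂ (∈-filter⁻ (clash? x) {xs = universe} y∈nx)))
    ...   | inj₂ ok′ = subst Good (++-assoc chosen [ x ] (filter P? xs))
                         (allGood-sound P? indep xs (++⁺ chosen⊆P (Px ∷ [])) ok′)

_⊑ˡ?_ : Decidable _⊑ˡ_
O ⊑ˡ? O = yes refl⊑
I ⊑ˡ? I = yes refl⊑
X ⊑ˡ? X = yes refl⊑
O ⊑ˡ? X = yes toX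
I ⊑ˡ? X = yes toX
O ⊑ˡ? I = no λ ()
I ⊑ˡ? O = no λ ()
X ⊑ˡ? O = no λ ()
X ⊑ˡ? I = no λ ()

_⊑?_ : Decidable _⊑_
u ⊑? w = all? λ i → lookup u i ⊑ˡ? lookup w i

_≟ˡ_ : DecidableEquality Letter
O ≟ˡ O = yes refl
I ≟ˡ I = yes refl
X ≟ˡ X = yes refl
O ≟ˡ I = no λ ()
O ≟ˡ X = no λ ()
I ≟ˡ O = no λ ()
I ≟ˡ X = no λ ()
X ≟ˡ O = no λ ()
X ≟ˡ I = no λ ()

_≟ʷ_ : DecidableEquality Word
_≟ʷ_ = ≡-dec _≟ˡ_

letters : List Letter
letters = O ∷ I ∷ X ∷ []

∈-letters : ∀ l → l ∈ letters
∈-letters O = here refl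
∈-letters I = there (here refl)
∈-letters X = there (there (here refl))

letters-unique : Unique letters
letters-unique = ((λ ()) ∷ (λ ()) ∷ []) ∷ ((λ ()) ∷ []) ∷ [] ∷ []

words : List Word
words = vectors letters 4

faces : ℕ → List Word
faces k = filter (λ w → dim w ℕ.≟ k) words

∈-faces : ∀ {k w} → w ∈ faces k ⇔ IsFace k w
∈-faces {k} {w} = mk⇔ (proj₂ ∘ ∈-filter⁻ (λ w → dim w ℕ.≟ k) {xs = words})
                      (∈-filter⁺ (λ w → dim w ℕ.≟ k) (∈-vectors ∈-letters w))

faces-unique : ∀ k → Unique (faces k)
faces-unique k = Unique.filter⁺ (λ w → dim w ℕ.≟ k) (vectors-unique letters-unique 4)

ridges : List Word
ridges = faces 2

flip : Letter → Letter
flip O = I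
flip I = O
flip X = X

opposite : Word → Word
opposite = Vec.map flip

antipodal-opposite : ∀ w → Antipodal w (opposite w)
antipodal-opposite w i rewrite lookup-map i flip w = flipped (lookup w i)
  where
  flipped : ∀ l → Antiˡ l (flip l)
  flipped O = OI
  flipped I = IO
  flipped X = XX

count-X-map-flip : ∀ {n} (w : Vec Letter n) →
  count (λ l → isX l Data.Bool.≟ true) (Vec.map flip w) ≡ count (λ l → isX l Data.Bool.≟ true) w
count-X-map-flip [] = refl
count-X-map-flip (O ∷ w) = count-X-map-flip w
count-X-map-flip (I ∷ w) = count-X-map-flip w
count-X-map-flip (X ∷ w) = cong suc (count-X-map-flip w)

dim-opposite : ∀ w → dim (opposite w) ≡ dim w
dim-opposite = count-X-map-flip

Clash : Word → Word → Set
Clash r r′ = Any (λ e → e ⊑ r × opposite e ⊑ r′) (faces 1)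

clash? : Decidable Clash
clash? r r′ = any? (λ e → (e ⊑? r) ×-dec (opposite e ⊑? r′)) (faces 1)

clash⇒antipodalEdges : ∀ {A r r′} → r ∈R A → r′ ∈R A → Clash r r′ → ContainsAntipodalEdges A
clash⇒antipodalEdges {r = r} {r′} r∈A r′∈A clash =
  let e , e∈edges , e⊑r , ē⊑r′ = find clash
      edge = to ∈-faces e∈edges
  in e , opposite e , edge , trans (dim-opposite e) edge , antipodal-opposite e
       , (r , r∈A , e⊑r) , (r′ , r′∈A , ē⊑r′)

open import Data.List.Membership.DecPropositional _≟ʷ_ using (_∈?_)

ListsRidges : (Word → Set) → List Word → Set
ListsRidges Q ys = All (λ r → (r ∈ ys → Q r) × (Q r → r ∈ ys)) ridges

listsRidges? : ∀ {Q} → U.Decidable Q → U.Decidable (ListsRidges Q)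
listsRidges? Q? ys = All.all? (λ r → (r ∈? ys →-dec Q? r) ×-dec (Q? r →-dec r ∈? ys)) ridges

FacetOrAsterisk : List Word → Set
FacetOrAsterisk ys = Any (λ F → ListsRidges (_⊑ F) ys) (faces 3)
                   ⊎ Any (λ v → ListsRidges (v ⊑_) ys) (faces 0)

Classified : List Word → Set
Classified ys = length ys ≤ 6 × (length ys ≡ 6 → FacetOrAsterisk ys)

classified? : U.Decidable Classified
classified? ys = (length ys ℕ.≤? 6) ×-dec ((length ys ℕ.≟ 6) →-dec facetOrAsterisk?)
  where
  facetOrAsterisk? : Dec (FacetOrAsterisk ys)
  facetOrAsterisk? = any? (λ F → listsRidges? (_⊑? F) ys) (faces 3)
                ⊎-dec any? (λ v → listsRidges? (v ⊑?_) ys) (faces 0)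

open IndependentSets _≟ʷ_ clash? ridges

clashFreeRidgeLists-classified : T (allGood classified? [] (withNeighbours ridges))
clashFreeRidgeLists-classified = tt

ridgesOf : RidgeSet → List Word
ridgesOf A = filter (λ r → T? (proj₁ A r)) ridges

∈-ridgesOf : ∀ {A w} → w ∈ ridgesOf A ⇔ w ∈R A
∈-ridgesOf {A} = mk⇔ (proj₂ ∘ ∈-filter⁻ (λ r → T? (proj₁ A r)) {xs = ridges})
                     (λ w∈A → ∈-filter⁺ (λ r → T? (proj₁ A r)) (from ∈-faces (proj₂ A _ w∈A)) w∈A)

hasCard-ridgesOf : ∀ A → HasCard A (length (ridgesOf A))
hasCard-ridgesOf A =
  ridgesOf A , Unique.filter⁺ (λ r → T? (proj₁ A r)) (faces-unique 2) , refl , λ _ → ∈-ridgesOf {A}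

noAntipodalEdges⇒classified : ∀ A → ¬ ContainsAntipodalEdges A → Classified (ridgesOf A)
noAntipodalEdges⇒classified A noAE =
  allGood-sound classified? (λ r → T? (proj₁ A r))
    (λ r∈A r′∈A → noAE ∘ clash⇒antipodalEdges {A} r∈A r′∈A) ridges [] clashFreeRidgeLists-classified

listsRidges⇒∈R-⇔ : ∀ {Q A} → ListsRidges Q (ridgesOf A) → ∀ r → r ∈R A ⇔ (IsRidge r × Q r)
listsRidges⇒∈R-⇔ {Q} {A} lists r = mk⇔
  (λ r∈A → let ridge = proj₂ A r r∈A
           in ridge , proj₁ (lists-at ridge) (from (∈-ridgesOf {A}) r∈A))
  (λ (ridge , Qr) → to (∈-ridgesOf {A}) (proj₂ (lists-at ridge) Qr))
  where
  lists-at : IsRidge r → (r ∈ ridgesOf A → Q r) × (Q r → r ∈ ridgesOf A)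
  lists-at ridge = All.lookup lists (from (∈-faces {w = r}) ridge)

facetOrAsterisk⇒ : ∀ {A} → FacetOrAsterisk (ridgesOf A) →
  (∃ λ F → IsFacet F × IsFacetSet A F) ⊎ (∃ λ v → IsVertex v × IsAst A v)
facetOrAsterisk⇒ {A} (inj₁ facet) = let F , F∈facets , lists = find facet
                                    in inj₁ (F , to ∈-faces F∈facets , listsRidges⇒∈R-⇔ {A = A} lists)
facetOrAsterisk⇒ {A} (inj₂ ast) = let v , v∈vertices , lists = find ast
                                  in inj₂ (v , to ∈-faces v∈vertices , listsRidges⇒∈R-⇔ {A = A} lists)

lemma7 : (As : Fin 4 → RidgeSet) → IsRidgeCover As
       → (∀ i → ¬ ContainsAntipodalEdges (As i))
       → ∀ i → HasCard (As i) 6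
             × ((∃ λ F → IsFacet F × IsFacetSet (As i) F) ⊎ (∃ λ v → IsVertex v × IsAst (As i) v))
lemma7 As cover noAE i =
  subst (HasCard (As i)) (size≡6 i) (hasCard-ridgesOf (As i)) ,
  facetOrAsterisk⇒ {As i} (proj₂ (classified i) (size≡6 i))
  where
  classified : ∀ i → Classified (ridgesOf (As i))
  classified i = noAntipodalEdges⇒classified (As i) (noAE i)
  -- length ridges computes to 24 = 4 * 6.
  size≡6 : ∀ i → length (ridgesOf (As i)) ≡ 6
  size≡6 = sum-maximal⇒terms-maximal (λ i → length (ridgesOf (As i))) (proj₁ ∘ classified)
             (length≤∑-length-filter (λ i r → T? (proj₁ (As i) r)) ridges (λ r∈ → cover _ (to ∈-faces r∈)))
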